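{- For every $m\ge 2$, the reverse of $R_m$ equals its complement; that is, if $R_m=[r_1,\ldots,r_N]$ then $r_k + r_{N+1-k} = m$ for all $1\le k\le N$.
   Context: Define sequences recursively by $R_2=[1]$ and, for $m\ge 3$, $R_m = (R_{m-1}+1)\cup[1,2,\ldots,m-1]\cup R_{m-1}$, where $\cup$ denotes concatenation of sequences and $R_{m-1}+1$ is obtained by adding $1$ to every entry of $R_{m-1}$. The complement of a sequence $[i_1,\ldots,i_N]$ (for $m$) is $[m-i_1,\ldots,m-i_N]$ and its reverse is $[i_N,\ldots,i_1]$. -}

module Defs where

open import Data.Nat using (ℕ; zero; suc; _+_)
open import Data.List using (List; []; _∷_; _++_; map; upTo)

oneTo : ℕ → List ℕ
oneTo n = map suc (upTo n)

-- R m for m ≥ 2 (R 0 and R 1 are junk values, never used).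
-- R 2 = [1];  R m = (R (m-1) + 1) ++ [1..m-1] ++ R (m-1)  for m ≥ 3.
R : ℕ → List ℕ
R zero = []
R (suc zero) = []
R (suc (suc zero)) = 1 ∷ []
R (suc (suc (suc k))) =
  map suc (R (suc (suc k))) ++ (oneTo (suc (suc k)) ++ R (suc (suc k)))

module Submission where

-- Write  comp m xs = map (m ∸_) xs  for the complement of a list
-- whose entries are at most m.  We show, by induction on m, the list identity
--   reverse (R m) ≡ comp m (R m)                                  (★)
-- Reversing  R (m+1) = (R m + 1) ++ [1..m] ++ R m  turns it into
--   reverse (R m) ++ reverse [1..m] ++ reverse (R m + 1),
-- and each block is the complement (for m+1) of the corresponding block of
-- R (m+1): reverse (R m) = comp m (R m) = comp (m+1) (R m + 1) by (★),
-- reverse [1..m] = comp (m+1) [1..m], and reverse (R m + 1) = comp m (R m) + 1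
-- = comp (m+1) (R m), the last step needing that all entries of R m are ≤ m.
-- Finally a list satisfying (★) with entries ≤ m has  x_k + x_{N-1-k} = m  at
-- every position, since x_{N-1-k} is the k-th entry of the reverse.

open import Defs
open import Data.Nat using (ℕ; _+_; _≤_)
open import Data.List using (length; lookup; reverse)
open import Data.Fin using (Fin; opposite)
open import Relation.Binary.PropositionalEquality using (_≡_)

open import Data.Nat using (zero; suc; _∸_; _<_; s≤s; z≤n)
open import Data.Nat.Properties
  using (+-∸-assoc; m≤n⇒m≤1+n; m≤n⇒m<n∨m≡n; n∸n≡0; m+[n∸m]≡n)
open import Data.List using (List; []; _∷_; _++_; map; upTo; [_])
open import Data.List.Properties
  using (map-upTo; upTo-∷ʳ; map-++; map-∘; reverse-++; reverse-map;
         unfold-reverse; length-reverse; ++-assoc)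
open import Data.List.Relation.Unary.All as All using (All; []; _∷_)
open import Data.List.Relation.Unary.All.Properties using (++⁺; map⁺)
import Data.Fin as Fin
open import Data.Fin using (toℕ)
open import Data.Fin.Properties using (opposite-prop; toℕ<n)
open import Data.Sum using (inj₁; inj₂)
open import Relation.Binary.PropositionalEquality
  using (refl; sym; trans; cong; cong₂; subst; module ≡-Reasoning)

oneTo-suc : ∀ m → oneTo (suc m) ≡ 1 ∷ map suc (oneTo m)
oneTo-suc m = cong (λ l → 1 ∷ map suc l) (sym (map-upTo suc m))

oneTo-snoc : ∀ m → oneTo (suc m) ≡ oneTo m ++ [ suc m ]
oneTo-snoc m = trans (cong (map suc) (sym (upTo-∷ʳ m))) (map-++ suc (upTo m) [ m ])

oneTo-bounded : ∀ m → All (_≤ m) (oneTo m)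
oneTo-bounded zero = []
oneTo-bounded (suc m) = subst (All (_≤ suc m)) (sym (oneTo-suc m))
  (s≤s z≤n ∷ map⁺ (All.map s≤s (oneTo-bounded m)))

comp : ℕ → List ℕ → List ℕ
comp m = map (m ∸_)

comp-map-suc : ∀ m xs → comp (suc m) (map suc xs) ≡ comp m xs
comp-map-suc m xs = sym (map-∘ xs)

map-suc-comp : ∀ m {xs} → All (_≤ m) xs → map suc (comp m xs) ≡ comp (suc m) xs
map-suc-comp m [] = refl
map-suc-comp m (x≤m ∷ xs≤m) =
  cong₂ _∷_ (sym (+-∸-assoc 1 x≤m)) (map-suc-comp m xs≤m)

reverse-oneTo : ∀ m → reverse (oneTo m) ≡ comp (suc m) (oneTo m)
reverse-oneTo zero = refl
reverse-oneTo (suc m) = begin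
  reverse (oneTo (suc m))                    ≡⟨ cong reverse (oneTo-snoc m) ⟩
  reverse (oneTo m ++ [ suc m ])             ≡⟨ reverse-++ (oneTo m) [ suc m ] ⟩
  suc m ∷ reverse (oneTo m)                  ≡⟨ cong (suc m ∷_) (reverse-oneTo m) ⟩
  suc m ∷ comp (suc m) (oneTo m)             ≡⟨ cong (suc m ∷_) (sym (comp-map-suc (suc m) (oneTo m))) ⟩
  suc m ∷ comp (suc (suc m)) (map suc (oneTo m))
                                             ≡⟨ cong (comp (suc (suc m))) (sym (oneTo-suc m)) ⟩
  comp (suc (suc m)) (oneTo (suc m))         ∎
  where open ≡-Reasoning

step : ℕ → List ℕ → List ℕ
step m C = map suc C ++ (oneTo m ++ C)

step-bounded : ∀ m {C} → All (_≤ m) C → All (_≤ suc m) (step m C)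
step-bounded m C≤m = ++⁺ (map⁺ (All.map s≤s C≤m))
  (++⁺ (All.map m≤n⇒m≤1+n (oneTo-bounded m)) (All.map m≤n⇒m≤1+n C≤m))

step-reverse : ∀ m C → All (_≤ m) C → reverse C ≡ comp m C →
               reverse (step m C) ≡ comp (suc m) (step m C)
step-reverse m C C≤m revC = begin
  reverse (map suc C ++ (B ++ C))
    ≡⟨ reverse-++ (map suc C) (B ++ C) ⟩
  reverse (B ++ C) ++ reverse (map suc C)
    ≡⟨ cong (_++ reverse (map suc C)) (reverse-++ B C) ⟩
  (reverse C ++ reverse B) ++ reverse (map suc C)
    ≡⟨ ++-assoc (reverse C) (reverse B) _ ⟩
  reverse C ++ (reverse B ++ reverse (map suc C))
    ≡⟨ cong (λ l → reverse C ++ (reverse B ++ l)) (sym (reverse-map suc C)) ⟩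
  reverse C ++ (reverse B ++ map suc (reverse C))
    ≡⟨ cong₂ (λ l l′ → l ++ (reverse B ++ map suc l′)) revC revC ⟩
  comp m C ++ (reverse B ++ map suc (comp m C))
    ≡⟨ cong₂ (λ l l′ → l ++ (l′ ++ map suc (comp m C)))
             (sym (comp-map-suc m C)) (reverse-oneTo m) ⟩
  comp (suc m) (map suc C) ++ (comp (suc m) B ++ map suc (comp m C))
    ≡⟨ cong (λ l → comp (suc m) (map suc C) ++ (comp (suc m) B ++ l))
            (map-suc-comp m C≤m) ⟩
  comp (suc m) (map suc C) ++ (comp (suc m) B ++ comp (suc m) C)
    ≡⟨ sym (trans (map-++ (suc m ∸_) (map suc C) (B ++ C))
                  (cong (comp (suc m) (map suc C) ++_) (map-++ (suc m ∸_) B C))) ⟩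
  comp (suc m) (map suc C ++ (B ++ C))
    ∎
  where
  open ≡-Reasoning
  B = oneTo m

-- The sequences R m, written R (2 + k) to avoid the junk values

R-bounded : ∀ k → All (_≤ 2 + k) (R (2 + k))
R-bounded zero = s≤s z≤n ∷ []
R-bounded (suc k) = step-bounded (2 + k) (R-bounded k)

R-reverse : ∀ k → reverse (R (2 + k)) ≡ comp (2 + k) (R (2 + k))
R-reverse zero = refl
R-reverse (suc k) = step-reverse (2 + k) (R (2 + k)) (R-bounded k) (R-reverse k)

-- Indexing by natural numbers (with a dummy value off the end) avoids
-- transporting Fin-indices along length equations.

nth : List ℕ → ℕ → ℕ
nth [] _ = 0
nth (x ∷ xs) zero = x
nth (x ∷ xs) (suc i) = nth xs i

lookup-nth : ∀ xs (k : Fin (length xs)) → lookup xs k ≡ nth xs (toℕ k)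
lookup-nth (x ∷ xs) Fin.zero = refl
lookup-nth (x ∷ xs) (Fin.suc k) = lookup-nth xs k

nth-++ˡ : ∀ xs ys i → i < length xs → nth (xs ++ ys) i ≡ nth xs i
nth-++ˡ (x ∷ xs) ys zero _ = refl
nth-++ˡ (x ∷ xs) ys (suc i) (s≤s i<n) = nth-++ˡ xs ys i i<n

nth-++-length : ∀ xs ys → nth (xs ++ ys) (length xs) ≡ nth ys 0
nth-++-length [] ys = refl
nth-++-length (x ∷ xs) ys = nth-++-length xs ys

nth-map : ∀ (f : ℕ → ℕ) xs i → i < length xs → nth (map f xs) i ≡ f (nth xs i)
nth-map f (x ∷ xs) zero _ = refl
nth-map f (x ∷ xs) (suc i) (s≤s i<n) = nth-map f xs i i<n

nth-bounded : ∀ {m} xs i → i < length xs → All (_≤ m) xs → nth xs i ≤ m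
nth-bounded (x ∷ xs) zero _ (x≤m ∷ _) = x≤m
nth-bounded (x ∷ xs) (suc i) (s≤s i<n) (_ ∷ xs≤m) = nth-bounded xs i i<n xs≤m

nth-reverse : ∀ xs i → i < length xs → nth (reverse xs) i ≡ nth xs (length xs ∸ suc i)
nth-reverse (x ∷ xs) i (s≤s i≤n) with m≤n⇒m<n∨m≡n i≤n
... | inj₁ i<n = begin
  nth (reverse (x ∷ xs)) i       ≡⟨ cong (λ l → nth l i) (unfold-reverse x xs) ⟩
  nth (reverse xs ++ [ x ]) i    ≡⟨ nth-++ˡ (reverse xs) [ x ] i
                                      (subst (i <_) (sym (length-reverse xs)) i<n) ⟩
  nth (reverse xs) i             ≡⟨ nth-reverse xs i i<n ⟩
  nth xs (length xs ∸ suc i)     ≡⟨ cong (nth (x ∷ xs)) (sym (+-∸-assoc 1 i<n)) ⟩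
  nth (x ∷ xs) (length xs ∸ i)   ∎
  where open ≡-Reasoning
... | inj₂ refl = begin
  nth (reverse (x ∷ xs)) (length xs)
    ≡⟨ cong (λ l → nth l (length xs)) (unfold-reverse x xs) ⟩
  nth (reverse xs ++ [ x ]) (length xs)
    ≡⟨ cong (nth (reverse xs ++ [ x ])) (sym (length-reverse xs)) ⟩
  nth (reverse xs ++ [ x ]) (length (reverse xs))
    ≡⟨ nth-++-length (reverse xs) [ x ] ⟩
  x
    ≡⟨ cong (nth (x ∷ xs)) (sym (n∸n≡0 (length xs))) ⟩
  nth (x ∷ xs) (length xs ∸ length xs)
    ∎
  where open ≡-Reasoning

mirror-sum : ∀ m xs → All (_≤ m) xs → reverse xs ≡ comp m xs →
             (k : Fin (length xs)) → lookup xs k + lookup xs (opposite k) ≡ m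
mirror-sum m xs xs≤m revxs k = begin
  lookup xs k + lookup xs (opposite k)
    ≡⟨ cong₂ _+_ (lookup-nth xs k)
                 (trans (lookup-nth xs (opposite k)) (cong (nth xs) (opposite-prop k))) ⟩
  nth xs i + nth xs (length xs ∸ suc i)
    ≡⟨ cong (nth xs i +_) (sym (nth-reverse xs i i<n)) ⟩
  nth xs i + nth (reverse xs) i
    ≡⟨ cong (λ l → nth xs i + nth l i) revxs ⟩
  nth xs i + nth (comp m xs) i
    ≡⟨ cong (nth xs i +_) (nth-map (m ∸_) xs i i<n) ⟩
  nth xs i + (m ∸ nth xs i)
    ≡⟨ m+[n∸m]≡n (nth-bounded xs i i<n xs≤m) ⟩
  m
    ∎
  where
  open ≡-Reasoning
  i = toℕ k
  i<n = toℕ<n k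

lemma2p2 : (m : ℕ) → 2 ≤ m → (k : Fin (length (R m))) →
    lookup (R m) k + lookup (R m) (opposite k) ≡ m
lemma2p2 (suc (suc k)) (s≤s (s≤s z≤n)) =
  mirror-sum (2 + k) (R (2 + k)) (R-bounded k) (R-reverse k)
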